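{- Let $x$ be a coloring and let $t\in B$ be such that for every $n\in\mathbb{N}$ there exist $a\in Q^+_n\cap C(B,t)$ and $b\in Q^-_n\cap C(B,t)$ such that $C(Q^+_n\cap B,a)$ and $C(Q^-_n\cap B,b)$ are both infinite. Let $*\in\{+,-\}$, and suppose that for every $n$, the set $Q^*_n\cap C(B,t)$ has only finitely many infinite connected components that intersect $\partial Q^*_n$. Then there exists a black path $(t_i)_{i\in\mathbb{N}}$ with $t_0=t$ that reaches to $*$.
   Context: Fix a regular hexagonal tiling of $\mathbb{R}^2$ in which some tile edges are horizontal, with tile set $T$; tiles are adjacent (neighbours) if they share an edge. A coloring is $x:T\to\{0,1\}$; $B=\{t: x(t)=1\}$ is the set of black tiles. For $X\subseteq T$ and $a\in X$, $C(X,a)$ is the connected component of $a$ in $X$ (w.r.t. adjacency). A path is a sequence of tiles indexed by an interval of $\mathbb{Z}$ with consecutive tiles adjacent; it is black if all tiles are in $B$. Fix tiles $(d_n)_{n\in\mathbb{Z}}$ with $d_n$ the northeast neighbour of $d_{n-1}$; $Q^+_n$ (resp. $Q^-_n$) is the set of tiles obtained from $d_n$ by translations by vectors in $[0,\infty)^2$ (resp. $(-\infty,0]^2$). $\partial Q^*_n$ is the set of tiles of $Q^*_n$ having a neighbour outside $Q^*_n$. A path $(t_i)_{i\in\mathbb{N}}$ reaches to $*$ if for every $n$ there is $i$ with $t_j\in Q^*_n$ for all $j\ge i$. -}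

module Defs where

open import Data.Bool using (Bool; true)
open import Data.Integer using (ℤ; +_; _+_; _-_; _*_; _≤_; -_)
open import Data.Nat using (ℕ; suc) renaming (_≤_ to _≤ℕ_)
open import Data.Product using (Σ; _×_; _,_; ∃)
open import Data.List using (List)
open import Data.List.Membership.Propositional using (_∈_)
open import Relation.Binary.PropositionalEquality using (_≡_)
open import Relation.Nullary using (¬_)

-- Tiles of the regular hexagonal tiling with horizontal edges ("flat-topped"
-- hexagons), in axial coordinates (q , r).  The centre of tile (q , r) is
--   ( (3/2) q , (√3/2) (q + 2 r) )   (for unit circumradius, origin tile at 0).
Tile : Set
Tile = ℤ × ℤ

-- centre coordinates, scaled by 2 (x-axis) and by 2/√3 (y-axis);
-- scaling by positive constants does not change signs.
cx : Tile → ℤ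
cx (q , r) = + 3 * q

cy : Tile → ℤ
cy (q , r) = q + (+ 2 * r)

data Dir : Set where
  N S NE NW SE SW : Dir

move : Dir → Tile → Tile
move N  (q , r) = (q , r + + 1)
move S  (q , r) = (q , r - + 1)
move NE (q , r) = (q + + 1 , r)
move SW (q , r) = (q - + 1 , r)
move SE (q , r) = (q + + 1 , r - + 1)
move NW (q , r) = (q - + 1 , r + + 1)

Adj : Tile → Tile → Set
Adj s s' = Σ Dir (λ δ → s' ≡ move δ s)

Coloring : Set
Coloring = Tile → Bool

TSet : Set₁
TSet = Tile → Set

Black : Coloring → TSet
Black x s = x s ≡ true

_∩_ : TSet → TSet → TSet
(X ∩ Y) s = X s × Y s

data C (X : TSet) (a : Tile) : TSet where
  here : X a → C X a a
  step : ∀ {s s'} → C X a s → Adj s s' → X s' → C X a s'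

Finite : TSet → Set
Finite X = Σ (List Tile) (λ l → ∀ s → X s → s ∈ l)

Infinite : TSet → Set
Infinite X = ¬ Finite X

Nonempty : TSet → Set
Nonempty X = ∃ X

dseq : Tile → ℤ → Tile
dseq (q , r) n = (q + n , r)

data Sign : Set where
  plus minus : Sign

-- Q^*_n : tiles s = d_n + v with v ∈ [0,∞)² (resp. (-∞,0]²),
-- i.e. the centre difference has both coordinates ≥ 0 (resp. ≤ 0)
Q : Tile → Sign → ℤ → TSet
Q d₀ plus  n s = (cx (dseq d₀ n) ≤ cx s) × (cy (dseq d₀ n) ≤ cy s)
Q d₀ minus n s = (cx s ≤ cx (dseq d₀ n)) × (cy s ≤ cy (dseq d₀ n))

∂ : TSet → TSet
∂ X s = X s × Σ Tile (λ s' → Adj s s' × ¬ X s')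

-- "X has only finitely many infinite connected components meeting Y":
-- there is a finite list of tiles whose components cover all such components
FinManyInfCompsMeeting : TSet → TSet → Set
FinManyInfCompsMeeting X Y =
  Σ (List Tile) (λ reps →
    ∀ s → X s → Infinite (C X s) → Nonempty (C X s ∩ Y) →
      Σ Tile (λ r → r ∈ reps × C X r s))

BlackPath : Coloring → (ℕ → Tile) → Set
BlackPath x f = (∀ i → Black x (f i)) × (∀ i → Adj (f i) (f (suc i)))

ReachesTo : Tile → Sign → (ℕ → Tile) → Set
ReachesTo d₀ σ f = ∀ n → Σ ℕ (λ i → ∀ j → i ≤ℕ j → Q d₀ σ n (f j))

module Submission where

-- For each depth k let X k be the part of C(B,t) lying in the k-th quadrant, with t pushed
-- outside every quadrant by a shift.  Each of the given infinite black components deeper than k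
-- sits in an infinite component of X k, which meets the boundary of the quadrant because it is
-- reached from t; so it is one of finitely many.  The infinite pigeonhole principle (a König-type
-- argument) then yields components r k of X k, each containing infinitely many of the given
-- components, with the component of r (k+1) inside that of r k.  Walking from t through these
-- nested components, always to a point deep enough to leave the previous one behind, gives the
-- black path.

open import Defs
open import Level using (0ℓ)
open import Axiom.ExcludedMiddle using (ExcludedMiddle)
open import Data.Nat using (ℕ; zero; suc; _⊔_; z≤n; s≤s; _≤′_; ≤′-refl; ≤′-step)
  renaming (_≤_ to _≤ℕ_; _+_ to _+ℕ_)
import Data.Nat.Properties as ℕ
open import Data.Nat.GeneralisedArithmetic using (iterate)
open import Data.Integer using (ℤ; +_; -[1+_]; _+_; _-_; _*_; _≤_; _<_; -_; ∣_∣; +≤+; +<+; -≤+)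
open import Data.Integer.Properties
  using (≤-refl; ≤-trans; ≤-<-trans; <⇒≱; neg-mono-≤; neg-mono-<; +-monoʳ-≤; +-monoˡ-≤;
         +-monoʳ-<; *-monoˡ-≤-nonNeg; *-cancelˡ-≤-pos)
open import Data.Integer.Tactic.RingSolver using (solve-∀)
open import Data.Product using (Σ; ∃; _×_; _,_; proj₁; proj₂)
open import Data.List using (List; []; _∷_)
open import Data.List.Relation.Unary.Any as Any using (Any; here; there)
open import Data.List.Membership.Propositional using (lose)
open import Data.Empty using (⊥-elim)
open import Relation.Nullary using (¬_; yes; no)
open import Relation.Unary using (Pred; _⊆_)
open import Relation.Binary.Core using (Rel)
open import Relation.Binary.Construct.Closure.ReflexiveTransitive using (Star; ε; _◅_; _◅◅_)
open import Relation.Binary.PropositionalEquality using (_≡_; _≢_; refl; cong₂; subst; sym)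

a≡a+1-1 : ∀ a → a ≡ (a + + 1) - + 1
a≡a+1-1 = solve-∀

a≡a-1+1 : ∀ a → a ≡ (a - + 1) + + 1
a≡a-1+1 = solve-∀

adj-sym : ∀ {s s'} → Adj s s' → Adj s' s
adj-sym {q , r} (N  , refl) = S  , cong₂ _,_ refl (a≡a+1-1 r)
adj-sym {q , r} (S  , refl) = N  , cong₂ _,_ refl (a≡a-1+1 r)
adj-sym {q , r} (NE , refl) = SW , cong₂ _,_ (a≡a+1-1 q) refl
adj-sym {q , r} (SW , refl) = NE , cong₂ _,_ (a≡a-1+1 q) refl
adj-sym {q , r} (SE , refl) = NW , cong₂ _,_ (a≡a+1-1 q) (a≡a-1+1 r)
adj-sym {q , r} (NW , refl) = SE , cong₂ _,_ (a≡a-1+1 q) (a≡a+1-1 r)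

C-member : ∀ {X a s} → C X a s → X s
C-member (here x)     = x
C-member (step _ _ x) = x

C-trans : ∀ {X a b c} → C X a b → C X b c → C X a c
C-trans p (here _)       = p
C-trans p (step q adj x) = step (C-trans p q) adj x

C-sym : ∀ {X a b} → C X a b → C X b a
C-sym (here x)       = here x
C-sym (step c adj x) = C-trans (step (here x) (adj-sym adj) (C-member c)) (C-sym c)

C-mono : ∀ {X Y : TSet} {a} → X ⊆ Y → C X a ⊆ C Y a
C-mono X⊆Y (here x)       = here (X⊆Y x)
C-mono X⊆Y (step c adj x) = step (C-mono X⊆Y c) adj (X⊆Y x)

Infinite-mono : ∀ {X Y : TSet} → X ⊆ Y → Infinite X → Infinite Y
Infinite-mono X⊆Y X-infinite (l , Y⊆l) = X-infinite (l , λ s x → Y⊆l s (X⊆Y x))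

C-within-component : ∀ {B P P' : TSet} {t a} → P' ⊆ P → C B t a → C (P' ∩ B) a ⊆ C (P ∩ C B t) a
C-within-component P'⊆P ta (here (p , _)) = here (P'⊆P p , ta)
C-within-component P'⊆P ta (step c adj (p , b)) =
  step c' adj (P'⊆P p , step (proj₂ (C-member c')) adj b)
  where c' = C-within-component P'⊆P ta c

antitone-≤ : ∀ {A : Set} (P : ℕ → Pred A 0ℓ) → (∀ k → P (suc k) ⊆ P k) →
             ∀ {k m} → k ≤ℕ m → P m ⊆ P k
antitone-≤ P P-antitone k≤m = go (ℕ.≤⇒≤′ k≤m)
  where
  go : ∀ {k m} → k ≤′ m → P m ⊆ P k
  go ≤′-refl          = λ p → p
  go (≤′-step {m} k≤m) = λ p → go k≤m (P-antitone m p)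

Eventually : (ℕ → Set) → Set
Eventually H = ∃ λ i → ∀ j → i ≤ℕ j → H j

Frequently : (ℕ → Set) → Set
Frequently H = ∀ i → ∃ λ j → i ≤ℕ j × H j

Frequently-map : ∀ {H G : ℕ → Set} → (∀ {m} → H m → G m) → Frequently H → Frequently G
Frequently-map f fr i = let (j , i≤j , h) = fr i in j , i≤j , f h

frequently-∩-eventually : ∀ {H G : ℕ → Set} → Frequently H → Eventually G → Frequently (λ m → H m × G m)
frequently-∩-eventually fr (k , ev) i =
  let (j , i⊔k≤j , h) = fr (i ⊔ k) in
  j , ℕ.≤-trans (ℕ.m≤m⊔n i k) i⊔k≤j , h , ev j (ℕ.≤-trans (ℕ.m≤n⊔m i k) i⊔k≤j)

module Classical (em : ExcludedMiddle 0ℓ) where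

  ¬frequently⇒eventually¬ : ∀ {H : ℕ → Set} → ¬ Frequently H → Eventually (λ m → ¬ H m)
  ¬frequently⇒eventually¬ {H} ¬fr with em {Eventually (λ m → ¬ H m)}
  ... | yes ev = ev
  ... | no ¬ev = ⊥-elim (¬fr fr)
    where
    fr : Frequently H
    fr i with em {∃ λ j → i ≤ℕ j × H j}
    ... | yes h = h
    ... | no ¬h = ⊥-elim (¬ev (i , λ j i≤j hj → ¬h (j , i≤j , hj)))

  pigeonhole : ∀ {A : Set} {R : A → ℕ → Set} (xs : List A) →
               Frequently (λ m → Any (λ a → R a m) xs) → Any (λ a → Frequently (R a)) xs
  pigeonhole [] fr with fr 0
  ... | _ , _ , ()
  pigeonhole {R = R} (a ∷ xs) fr with em {Frequently (R a)}
  ... | yes fr-a = here fr-a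
  ... | no ¬fr-a = there (pigeonhole xs (Frequently-map drop-a
                     (frequently-∩-eventually fr (¬frequently⇒eventually¬ ¬fr-a))))
    where
    drop-a : ∀ {m} → Any (λ a → R a m) (a ∷ xs) × ¬ R a m → Any (λ a → R a m) xs
    drop-a (here r  , ¬r) = ⊥-elim (¬r r)
    drop-a (there r , _)  = r

  entry-through-boundary : ∀ {B P : TSet} {t s} → ¬ P t → C B t s → P s →
                           ∃ λ b → ∂ P b × C (P ∩ C B t) b s
  entry-through-boundary t∉P (here _) t∈P = ⊥-elim (t∉P t∈P)
  entry-through-boundary {P = P} t∉P (step {s} {s'} c adj b) s'∈P with em {P s}
  ... | yes s∈P = let (e , ∂e , ce) = entry-through-boundary t∉P c s∈P in
                  e , ∂e , step ce adj (s'∈P , step c adj b)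
  ... | no  s∉P = s' , (s'∈P , s , adj-sym adj , s∉P) , here (s'∈P , step c adj b)

Star-uncons : ∀ {A : Set} {T : Rel A 0ℓ} {a c} → Star T a c → a ≢ c → ∃ λ b → T a b × Star T b c
Star-uncons ε       a≢a = ⊥-elim (a≢a refl)
Star-uncons (x ◅ p) _   = _ , x , p

Step : ∀ {A : Set} → Rel A 0ℓ → Pred A 0ℓ → Rel A 0ℓ
Step _~_ Y a b = a ~ b × Y b

C⇒Star : ∀ {X a s} → C X a s → Star (Step Adj X) a s
C⇒Star (here _)       = ε
C⇒Star (step c adj x) = C⇒Star c ◅◅ ((adj , x) ◅ ε)

module Concatenation {A : Set} (_~_ : Rel A 0ℓ) (Y : ℕ → Pred A 0ℓ)
  (Y-antitone : ∀ k → Y (suc k) ⊆ Y k) (q : ℕ → A) (y₀ : Y 0 (q 0))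
  (segment : ∀ k → Star (Step _~_ (Y k)) (q k) (q (suc k)))
  (segment-nonempty : ∀ k → q k ≢ q (suc k)) where

  record Position : Set where
    constructor at
    field
      level : ℕ
      tile  : A
      tile∈ : Y level tile
      rest  : Star (Step _~_ (Y level)) tile (q (suc level))
  open Position

  first-step : ∀ k → ∃ λ b → Step _~_ (Y k) (q k) b × Star (Step _~_ (Y k)) b (q (suc k))
  first-step k = Star-uncons (segment k) (segment-nonempty k)

  next : Position → Position
  next (at k c y ((_ , y') ◅ rest)) = at k _ y' rest
  next (at k c y ε) = let (b , (_ , yb) , rest) = first-step (suc k) in at (suc k) b yb rest

  next-~ : ∀ p → tile p ~ tile (next p)
  next-~ (at k c y ((c~b , _) ◅ rest)) = c~b
  next-~ (at k c y ε)                 = proj₁ (proj₁ (proj₂ (first-step (suc k))))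

  next-level : ∀ p → level p ≤ℕ level (next p)
  next-level (at k c y (_ ◅ _)) = ℕ.≤-refl
  next-level (at k c y ε)       = ℕ.n≤1+n k

  iterate-level : ∀ p n → level p ≤ℕ level (iterate next p n)
  iterate-level p zero    = ℕ.≤-refl
  iterate-level p (suc n) = ℕ.≤-trans (next-level p) (iterate-level (next p) n)

  iterate-+ : ∀ p m n → iterate next p (m +ℕ n) ≡ iterate next (iterate next p m) n
  iterate-+ p zero    n = refl
  iterate-+ p (suc m) n = iterate-+ (next p) m n

  level-rises : ∀ p → ∃ λ n → suc (level p) ≤ℕ level (iterate next p n)
  level-rises (at k c y p) = along p
    where
    along : ∀ {c y} (p : Star (Step _~_ (Y k)) c (q (suc k))) →
            ∃ λ n → suc k ≤ℕ level (iterate next (at k c y p) n)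
    along ε                 = 1 , ℕ.≤-refl
    along ((_ , y') ◅ rest) = let (n , rises) = along {y = y'} rest in suc n , rises

  iterate-suc : ∀ p n → iterate next p (suc n) ≡ next (iterate next p n)
  iterate-suc p zero    = refl
  iterate-suc p (suc n) = iterate-suc (next p) n

  position : ℕ → Position
  position = iterate next (at 0 (q 0) y₀ (segment 0))

  walk : ℕ → A
  walk i = tile (position i)

  walk-step : ∀ i → walk i ~ walk (suc i)
  walk-step i = subst (λ p → walk i ~ tile p) (sym (iterate-suc _ i)) (next-~ (position i))

  level-mono : ∀ {i j} → i ≤ℕ j → level (position i) ≤ℕ level (position j)
  level-mono {i} i≤j with ℕ.m≤n⇒∃[o]m+o≡n i≤j
  ... | n , refl = subst (λ p → level (position i) ≤ℕ level p) (sym (iterate-+ _ i n))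
                         (iterate-level (position i) n)

  level-unbounded : ∀ k → ∃ λ i → k ≤ℕ level (position i)
  level-unbounded zero    = 0 , z≤n
  level-unbounded (suc k) =
    let (i , k≤) = level-unbounded k ; (n , rises) = level-rises (position i) in
    i +ℕ n , ℕ.≤-trans (s≤s k≤) (subst (λ p → suc (level (position i)) ≤ℕ level p)
                                         (sym (iterate-+ _ i n)) rises)

  walk-eventually : ∀ k → Eventually (λ i → Y k (walk i))
  walk-eventually k =
    let (i , k≤) = level-unbounded k in
    i , λ j i≤j → antitone-≤ Y Y-antitone (ℕ.≤-trans k≤ (level-mono i≤j)) (tile∈ (position j))

  walk-Y₀ : ∀ i → Y 0 (walk i)
  walk-Y₀ i = antitone-≤ Y Y-antitone z≤n (tile∈ (position i))

module Escape (em : ExcludedMiddle 0ℓ) {B : TSet} {t : Tile} (t-black : B t)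
  (P : ℕ → TSet) (P-antitone : ∀ k → P (suc k) ⊆ P k)
  (P-excludes : ∀ s → ∃ λ k → ¬ P k s) (t∉P₀ : ¬ P 0 t)
  (deep : ∀ m → ∃ λ a → P m a × C B t a × Infinite (C (P m ∩ B) a))
  (few : ∀ k → FinManyInfCompsMeeting (P k ∩ C B t) (∂ (P k))) where

  open Classical em

  X : ℕ → TSet
  X k = P k ∩ C B t

  X-antitone : ∀ k → X (suc k) ⊆ X k
  X-antitone k (p , c) = P-antitone k p , c

  a : ℕ → Tile
  a m = proj₁ (deep m)

  P-antitone-≤ : ∀ {k m} → k ≤ℕ m → P m ⊆ P k
  P-antitone-≤ = antitone-≤ P P-antitone

  t∉P : ∀ k → ¬ P k t
  t∉P k t∈P = t∉P₀ (P-antitone-≤ z≤n t∈P)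

  a∈P : ∀ {k m} → k ≤ℕ m → P k (a m)
  a∈P {m = m} k≤m = P-antitone-≤ k≤m (proj₁ (proj₂ (deep m)))

  a-covered : ∀ {k m} → k ≤ℕ m → Any (λ r → C (X k) r (a m)) (proj₁ (few k))
  a-covered {k} {m} k≤m =
    let (_ , _ , t-a , a-infinite) = deep m
        (e , ∂e , e-a) = entry-through-boundary (t∉P k) t-a (a∈P k≤m)
        (r , r∈ , r-a) = proj₂ (few k) (a m) (a∈P k≤m , t-a)
                           (Infinite-mono (C-within-component (P-antitone-≤ k≤m) t-a) a-infinite)
                           (e , C-sym e-a , ∂e)
    in lose r∈ r-a

  Good : ℕ → Tile → Set
  Good k r = Frequently (λ m → C (X k) r (a m))

  good₀ : ∃ (Good 0)
  good₀ = Any.satisfied (pigeonhole (proj₁ (few 0)) λ m → m , ℕ.≤-refl , a-covered z≤n)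

  good-suc : ∀ {k r} → Good k r → ∃ λ r' → Good (suc k) r' × C (X k) r r'
  good-suc {k} {r} good =
    let (r' , fr) = Any.satisfied (pigeonhole (proj₁ (few (suc k)))
                      (Frequently-map (λ (r-a , k<m) → Any.map (r-a ,_) (a-covered k<m))
                        (frequently-∩-eventually good (suc k , λ _ k<m → k<m))))
        (_ , _ , r-a , r'-a) = fr 0
    in r' , Frequently-map proj₂ fr , C-trans r-a (C-sym (C-mono (X-antitone k) r'-a))

  chain : ∀ k → ∃ (Good k)
  chain zero    = good₀
  chain (suc k) = let (r' , good' , _) = good-suc (proj₂ (chain k)) in r' , good'

  chain-link : ∀ k → C (X k) (proj₁ (chain k)) (proj₁ (chain (suc k)))
  chain-link k = proj₂ (proj₂ (good-suc (proj₂ (chain k))))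

  good-deep : ∀ {k r} → Good k r → ∀ E → ∃ λ p → C (X k) r p × P E p
  good-deep good E = let (m , E≤m , r-a) = good E in a m , r-a , a∈P E≤m

  -- Each waypoint lies in a P excluding the previous one, so consecutive waypoints differ.
  mutual
    depth : ℕ → ℕ
    depth zero    = 0
    depth (suc k) = proj₁ (P-excludes (waypoint k))

    waypoint : ℕ → Tile
    waypoint k = proj₁ (good-deep (proj₂ (chain k)) (depth k))

  waypoint-C : ∀ k → C (X k) (proj₁ (chain k)) (waypoint k)
  waypoint-C k = proj₁ (proj₂ (good-deep (proj₂ (chain k)) (depth k)))

  waypoint-P : ∀ k → P (depth k) (waypoint k)
  waypoint-P k = proj₂ (proj₂ (good-deep (proj₂ (chain k)) (depth k)))

  Y : ℕ → TSet
  Y zero    = B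
  Y (suc k) = X k

  Y-antitone : ∀ k → Y (suc k) ⊆ Y k
  Y-antitone zero    = λ x → C-member (proj₂ x)
  Y-antitone (suc k) = X-antitone k

  q : ℕ → Tile
  q zero    = t
  q (suc k) = waypoint k

  segment : ∀ k → C (Y k) (q k) (q (suc k))
  segment zero    = proj₂ (C-member (waypoint-C 0))
  segment (suc k) = C-trans (C-sym (waypoint-C k))
                            (C-trans (chain-link k) (C-mono (X-antitone k) (waypoint-C (suc k))))

  segment-nonempty : ∀ k → q k ≢ q (suc k)
  segment-nonempty zero    t≡w = t∉P₀ (subst (P 0) (sym t≡w) (waypoint-P 0))
  segment-nonempty (suc k) w≡w' =
    proj₂ (P-excludes (waypoint k)) (subst (P (depth (suc k))) (sym w≡w') (waypoint-P (suc k)))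

  module Path = Concatenation Adj Y Y-antitone q t-black (λ k → C⇒Star (segment k)) segment-nonempty
  open Path public using (walk; walk-step; walk-Y₀)

  walk-eventually : ∀ k → Eventually (λ i → P k (walk i))
  walk-eventually k = let (i , ev) = Path.walk-eventually (suc k) in i , λ j i≤j → proj₁ (ev j i≤j)

Beyond : Sign → ℤ → ℤ → Set
Beyond plus  n n' = n ≤ n'
Beyond minus n n' = n' ≤ n

Q-antitone : ∀ d₀ σ {n n'} → Beyond σ n n' → Q d₀ σ n' ⊆ Q d₀ σ n
Q-antitone (q₀ , r₀) plus  n≤n' (x≤ , y≤) =
  ≤-trans (*-monoˡ-≤-nonNeg (+ 3) (+-monoʳ-≤ q₀ n≤n')) x≤ ,
  ≤-trans (+-monoˡ-≤ (+ 2 * r₀) (+-monoʳ-≤ q₀ n≤n')) y≤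
Q-antitone (q₀ , r₀) minus n'≤n (≤x , ≤y) =
  ≤-trans ≤x (*-monoˡ-≤-nonNeg (+ 3) (+-monoʳ-≤ q₀ n'≤n)) ,
  ≤-trans ≤y (+-monoˡ-≤ (+ 2 * r₀) (+-monoʳ-≤ q₀ n'≤n))

toward : Sign → ℕ → ℤ
toward plus  k = + k
toward minus k = - (+ k)

toward-beyond : ∀ σ {k m} → k ≤ℕ m → Beyond σ (toward σ k) (toward σ m)
toward-beyond plus  k≤m = +≤+ k≤m
toward-beyond minus k≤m = neg-mono-≤ (+≤+ k≤m)

Q-toward-antitone : ∀ d₀ σ {k m} → k ≤ℕ m → Q d₀ σ (toward σ m) ⊆ Q d₀ σ (toward σ k)
Q-toward-antitone d₀ σ k≤m = Q-antitone d₀ σ (toward-beyond σ k≤m)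

i≤+∣i∣ : ∀ i → i ≤ + ∣ i ∣
i≤+∣i∣ (+ n)    = ≤-refl
i≤+∣i∣ -[1+ n ] = -≤+

-+∣i∣≤i : ∀ i → - (+ ∣ i ∣) ≤ i
-+∣i∣≤i (+ zero)  = ≤-refl
-+∣i∣≤i (+ suc n) = -≤+
-+∣i∣≤i -[1+ n ]  = ≤-refl

Q-toward-covers : ∀ d₀ σ n → ∃ λ k → Q d₀ σ (toward σ k) ⊆ Q d₀ σ n
Q-toward-covers d₀ plus  n = ∣ n ∣ , Q-antitone d₀ plus (i≤+∣i∣ n)
Q-toward-covers d₀ minus n = ∣ n ∣ , Q-antitone d₀ minus (-+∣i∣≤i n)

b<a+1+∣b-a∣ : ∀ a b → b < a + + suc ∣ b - a ∣
b<a+1+∣b-a∣ a b = subst (_< a + + suc ∣ b - a ∣) (b≡a+[b-a] a b)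
                    (+-monoʳ-< a (≤-<-trans (i≤+∣i∣ (b - a)) (+<+ (ℕ.n<1+n _))))
  where b≡a+[b-a] : ∀ a b → a + (b - a) ≡ b
        b≡a+[b-a] = solve-∀

a-1-∣a-b∣<b : ∀ a b → a + - (+ suc ∣ a - b ∣) < b
a-1-∣a-b∣<b a b = subst (a + - (+ suc ∣ a - b ∣) <_) (b≡a-[a-b] a b)
                    (+-monoʳ-< a (neg-mono-< (≤-<-trans (i≤+∣i∣ (a - b)) (+<+ (ℕ.n<1+n _)))))
  where b≡a-[a-b] : ∀ a b → a + - (a - b) ≡ b
        b≡a-[a-b] = solve-∀

Q-toward-excludes : ∀ d₀ σ s → ∃ λ k → ¬ Q d₀ σ (toward σ k) s
Q-toward-excludes (q₀ , r₀) plus (q , r) = suc ∣ q - q₀ ∣ , λ (x≤ , _) →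
  <⇒≱ (b<a+1+∣b-a∣ q₀ q) (*-cancelˡ-≤-pos _ q (+ 3) x≤)
Q-toward-excludes (q₀ , r₀) minus (q , r) = suc ∣ q₀ - q ∣ , λ (≤x , _) →
  <⇒≱ (a-1-∣a-b∣<b q₀ q) (*-cancelˡ-≤-pos q _ (+ 3) ≤x)

deep-on-side : ∀ {d₀ x t n} σ →
  Σ Tile (λ a → Σ Tile (λ b →
    Q d₀ plus n a × C (Black x) t a × Q d₀ minus n b × C (Black x) t b ×
    Infinite (C (Q d₀ plus n ∩ Black x) a) × Infinite (C (Q d₀ minus n ∩ Black x) b))) →
  ∃ λ a → Q d₀ σ n a × C (Black x) t a × Infinite (C (Q d₀ σ n ∩ Black x) a)
deep-on-side plus  (a , b , qa , ca , qb , cb , ia , ib) = a , qa , ca , ia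
deep-on-side minus (a , b , qa , ca , qb , cb , ia , ib) = b , qb , cb , ib

lemma1 : ExcludedMiddle 0ℓ → (d₀ : Tile) → (x : Coloring) → (t : Tile) → Black x t →
    (∀ (n : ℤ) →
      Σ Tile (λ a → Σ Tile (λ b →
        Q d₀ plus n a × C (Black x) t a × Q d₀ minus n b × C (Black x) t b ×
        Infinite (C (Q d₀ plus n ∩ Black x) a) × Infinite (C (Q d₀ minus n ∩ Black x) b)))) →
    (σ : Sign) →
    (∀ (n : ℤ) → FinManyInfCompsMeeting (Q d₀ σ n ∩ C (Black x) t) (∂ (Q d₀ σ n))) →
    Σ (ℕ → Tile) (λ f → BlackPath x f × f 0 ≡ t × ReachesTo d₀ σ f)
lemma1 em d₀ x t t-black deep σ few = walk , (walk-Y₀ , walk-step) , refl , reaches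
  where
  K : ℕ
  K = proj₁ (Q-toward-excludes d₀ σ t)

  -- Shifting by K puts t outside P 0.
  P : ℕ → TSet
  P k = Q d₀ σ (toward σ (k +ℕ K))

  P-excludes : ∀ s → ∃ λ k → ¬ P k s
  P-excludes s = let (k , s∉) = Q-toward-excludes d₀ σ s in
                 k , λ s∈ → s∉ (Q-toward-antitone d₀ σ (ℕ.m≤m+n k K) s∈)

  open Escape em t-black P (λ k → Q-toward-antitone d₀ σ (ℕ.n≤1+n (k +ℕ K))) P-excludes
    (proj₂ (Q-toward-excludes d₀ σ t))
    (λ k → deep-on-side σ (deep (toward σ (k +ℕ K))))
    (λ k → few (toward σ (k +ℕ K)))

  reaches : ReachesTo d₀ σ walk
  reaches n =
    let (k , Qk⊆Qn) = Q-toward-covers d₀ σ n ; (i , ev) = walk-eventually k in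
    i , λ j i≤j → Qk⊆Qn (Q-toward-antitone d₀ σ (ℕ.m≤m+n k K) (ev j i≤j))
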